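{- Let $k\in\mathbb{N}$ and $S=\langle 6k+5,6k+7,6k+11\rangle$. Then \[\mathrm{Ap}(S,6k+5)=\{a(6k+7)+b(6k+11)\mid (a,b)\in C\},\] where $C=\big(\{0,1,2\}\times\{0,1,\dots,2k+1\}\big)\setminus\{(2,2k+1)\}$.
   Context: $\mathbb{N}=\{0,1,2,\dots\}$. For $X\subseteq\mathbb{N}$, $\langle X\rangle$ is the submonoid of $(\mathbb{N},+)$ generated by $X$; here it is a numerical semigroup (a submonoid of $\mathbb{N}$ with finite complement). For a numerical semigroup $S$ and $n\in S\setminus\{0\}$, the Apéry set is $\mathrm{Ap}(S,n)=\{s\in S\mid s-n\notin S\}$. -}

module Defs where

open import Data.Nat using (ℕ; zero; suc; _+_; _*_; _∸_; _≤_; _<_)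
open import Data.List using (List; []; _∷_)
open import Data.List.Membership.Propositional using (_∈_)
open import Data.Product using (_×_; ∃; _,_)
open import Relation.Nullary using (¬_)
open import Relation.Binary.PropositionalEquality using (_≡_)

data ⟨_⟩ (X : List ℕ) : ℕ → Set where
  zero∈ : ⟨ X ⟩ 0
  step∈ : ∀ {g s} → g ∈ X → ⟨ X ⟩ s → ⟨ X ⟩ (g + s)

-- Apéry set of S = ⟨ X ⟩ w.r.t. n : s ∈ S and s - n ∉ S
-- (in ℤ; s - n < 0 is never in S, so s - n ∈ S means n ≤ s and s ∸ n ∈ S).
Apéry : List ℕ → ℕ → ℕ → Set
Apéry X n s = ⟨ X ⟩ s × ¬ (n ≤ s × ⟨ X ⟩ (s ∸ n))

C : ℕ → ℕ → ℕ → Set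
C k a b = a ≤ 2 × b ≤ 2 * k + 1 × ¬ (a ≡ 2 × b ≡ 2 * k + 1)

-- Write elements as u n + 2 r with n = 6k+5, so that the generators n, n+2, n+6
-- contribute (u, r) = (1, 0), (1, 1), (1, 3). For (a, b) ∈ C the element
-- a(n+2) + b(n+6) has r = a + 3b < n, and as n is odd every other representation
-- of it arises by moving multiples of (2, -n) in (u, r). Comparing 3u - r, which
-- is 2a ≤ 4 here but at least 3 + 3x + 2c for n plus a combination with
-- coefficients x, c, d, shows that subtracting n leaves the semigroup.
-- Conversely, a combination of the generators with a positive coefficient of n,
-- or with coefficients (c, d) ∉ C of n+2 and n+6, lies in n + S by one of
-- 3(n+2) = 2n + (n+6), (2k+2)(n+6) = (2k+3)n + (n+2), 2(n+2) + (2k+1)(n+6) = (2k+5)n.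
module Submission where

open import Defs
open import Data.Nat using (ℕ; zero; suc; _+_; _*_; _≤_; _<_; z≤n; s≤s)
open import Data.Nat.Properties
open import Data.Nat.Divisibility using (_∣_; divides; ∣m+n∣m⇒∣n; m∣m*n)
open import Data.Nat.Tactic.RingSolver using (solve-∀; solve)
open import Data.List using (List; _∷_; [])
open import Data.List.Membership.Propositional using (_∈_)
open import Data.List.Relation.Unary.Any using (here; there)
open import Data.Product using (_×_; ∃-syntax; _,_; proj₁)
open import Data.Sum using (_⊎_; inj₁; inj₂; map)
open import Data.Empty using (⊥-elim)
open import Function.Bundles using (_⇔_; mk⇔)
open import Relation.Binary.PropositionalEquality
open import Relation.Nullary using (¬_)

⟨⟩-+ : ∀ {X p q} → ⟨ X ⟩ p → ⟨ X ⟩ q → ⟨ X ⟩ (p + q)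
⟨⟩-+ zero∈ q∈ = q∈
⟨⟩-+ {X} {q = q} (step∈ {g} {s} g∈X s∈) q∈ =
  subst ⟨ X ⟩ (sym (+-assoc g s q)) (step∈ g∈X (⟨⟩-+ s∈ q∈))

⟨⟩-* : ∀ {X g} m → g ∈ X → ⟨ X ⟩ (m * g)
⟨⟩-* zero    g∈X = zero∈
⟨⟩-* (suc m) g∈X = step∈ g∈X (⟨⟩-* m g∈X)

module _ {g₁ g₂ g₃ : ℕ} where

  combination∈⟨⟩ : ∀ x y z → ⟨ g₁ ∷ g₂ ∷ g₃ ∷ [] ⟩ (x * g₁ + y * g₂ + z * g₃)
  combination∈⟨⟩ x y z =
    ⟨⟩-+ (⟨⟩-+ (⟨⟩-* x (here refl)) (⟨⟩-* y (there (here refl))))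
         (⟨⟩-* z (there (there (here refl))))

  ∈⟨⟩⇒combination : ∀ {s} → ⟨ g₁ ∷ g₂ ∷ g₃ ∷ [] ⟩ s →
                    ∃[ x ] ∃[ y ] ∃[ z ] s ≡ x * g₁ + y * g₂ + z * g₃
  ∈⟨⟩⇒combination zero∈ = 0 , 0 , 0 , refl
  ∈⟨⟩⇒combination (step∈ (here refl) s∈) with ∈⟨⟩⇒combination s∈
  ... | x , y , z , refl = suc x , y , z , solve (x ∷ y ∷ z ∷ g₁ ∷ g₂ ∷ g₃ ∷ [])
  ∈⟨⟩⇒combination (step∈ (there (here refl)) s∈) with ∈⟨⟩⇒combination s∈
  ... | x , y , z , refl = x , suc y , z , solve (x ∷ y ∷ z ∷ g₁ ∷ g₂ ∷ g₃ ∷ [])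
  ∈⟨⟩⇒combination (step∈ (there (there (here refl))) s∈) with ∈⟨⟩⇒combination s∈
  ... | x , y , z , refl = x , y , suc z , solve (x ∷ y ∷ z ∷ g₁ ∷ g₂ ∷ g₃ ∷ [])

Apéry-intro : ∀ {X n s} → ⟨ X ⟩ s → (∀ {t} → ⟨ X ⟩ t → s ≢ n + t) → Apéry X n s
Apéry-intro s∈ s≢n+t = s∈ , λ (n≤s , s∸n∈) → s≢n+t s∸n∈ (sym (m+[n∸m]≡n n≤s))

Apéry⇒≢n+ : ∀ {X n s t} → Apéry X n s → ⟨ X ⟩ t → s ≢ n + t
Apéry⇒≢n+ {X} {n} {t = t} (_ , s∸n∉) t∈ refl =
  s∸n∉ (m≤m+n n t , subst ⟨ X ⟩ (sym (m+n∸m≡n n t)) t∈)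

m≤n⊎m≡1+n+o : ∀ m n → m ≤ n ⊎ ∃[ o ] m ≡ suc (n + o)
m≤n⊎m≡1+n+o zero    n       = inj₁ z≤n
m≤n⊎m≡1+n+o (suc m) zero    = inj₂ (m , refl)
m≤n⊎m≡1+n+o (suc m) (suc n) = map s≤s (λ (o , eq) → o , cong suc eq) (m≤n⊎m≡1+n+o m n)

2∣*odd⇒2∣ : ∀ {n m} e → n ≡ suc (2 * m) → 2 ∣ e * n → 2 ∣ e
2∣*odd⇒2∣ {m = m} e refl 2∣e*n =
  ∣m+n∣m⇒∣n (subst (2 ∣_) (*-suc-double e m) 2∣e*n) (m∣m*n (e * m))
  where
  *-suc-double : ∀ e m → e * suc (2 * m) ≡ 2 * (e * m) + e
  *-suc-double = solve-∀

halve-odd-multiple : ∀ {n m} e r {r′} → n ≡ suc (2 * m) →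
                     e * n + 2 * r ≡ 2 * r′ → ∃[ t ] e ≡ 2 * t × r′ ≡ t * n + r
halve-odd-multiple {n} {m} e r {r′} odd eq with 2∣*odd⇒2∣ {m = m} e odd 2∣e*n
  where
  2∣e*n : 2 ∣ e * n
  2∣e*n = ∣m+n∣m⇒∣n (subst (2 ∣_) (trans (sym eq) (+-comm (e * n) (2 * r))) (m∣m*n r′)) (m∣m*n r)
... | divides t refl =
  t , *-comm t 2 , *-cancelˡ-≡ r′ (t * n + r) 2 (trans (sym eq) (solve (t ∷ n ∷ r ∷ [])))

[m+n]*o+p≡m*o+[n*o+p] : ∀ m n o p → (m + n) * o + p ≡ m * o + (n * o + p)
[m+n]*o+p≡m*o+[n*o+p] m n o p = trans (cong (_+ p) (*-distribʳ-+ o m n)) (+-assoc (m * o) (n * o) p)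

shift-odd-multiple : ∀ {n m} u v {r r′} → n ≡ suc (2 * m) → r < n →
                     u * n + 2 * r ≡ v * n + 2 * r′ → ∃[ t ] u ≡ v + 2 * t × r′ ≡ t * n + r
shift-odd-multiple {n} {m} u v {r} {r′} odd r<n eq with ≤-total v u
... | inj₁ v≤u with m≤n⇒∃[o]m+o≡n v≤u
...   | e , refl
  with halve-odd-multiple {m = m} e r {r′} odd
         (+-cancelˡ-≡ (v * n) _ _ (trans (sym ([m+n]*o+p≡m*o+[n*o+p] v e n _)) eq))
...     | t , refl , r′≡ = t , refl , r′≡
shift-odd-multiple {n} {m} u v {r} {r′} odd r<n eq | inj₂ u≤v with m≤n⇒∃[o]m+o≡n u≤v
...   | e , refl
  with halve-odd-multiple {m = m} e r′ {r} odd
         (sym (+-cancelˡ-≡ (u * n) _ _ (trans eq ([m+n]*o+p≡m*o+[n*o+p] u e n _))))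
...     | zero  , refl , refl = 0 , solve (u ∷ []) , refl
...     | suc t , _    , refl = ⊥-elim (<⇒≱ r<n (≤-trans (m≤m+n n _) (m≤m+n _ r′)))

-- Every term except 2 * a has the form `variable * constant`, so that it
-- reduces to a numeral once the variables are split into zero and suc.
defect-absurd : ∀ {a x t c} n → a ≤ 2 → 2 * a ≢ 3 + x * 3 + t * (6 + n) + c * 2
defect-absurd n z≤n ()
defect-absurd n (s≤s z≤n) ()
defect-absurd {x = zero}  {zero}  {zero}  n (s≤s (s≤s z≤n)) ()
defect-absurd {x = zero}  {zero}  {suc c} n (s≤s (s≤s z≤n)) ()
defect-absurd {x = zero}  {suc t}         n (s≤s (s≤s z≤n)) ()
defect-absurd {x = suc x}                 n (s≤s (s≤s z≤n)) ()

defect : ∀ n {a b x c d t} → a + b ≡ suc (x + c + d) + 2 * t → c + 3 * d ≡ t * n + (a + 3 * b) →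
         2 * a ≡ 3 + x * 3 + t * (6 + n) + c * 2
defect n {a} {b} {x} {c} {d} {t} h₁ h₂ = +-cancelʳ-≡ (a + 3 * b + (c + 3 * d)) _ _ (begin
  2 * a + (a + 3 * b + (c + 3 * d))
    ≡⟨ solve (a ∷ b ∷ c ∷ d ∷ []) ⟩
  3 * (a + b) + (c + 3 * d)
    ≡⟨ cong₂ (λ u r → 3 * u + r) h₁ h₂ ⟩
  3 * (suc (x + c + d) + 2 * t) + (t * n + (a + 3 * b))
    ≡⟨ solve (n ∷ a ∷ b ∷ x ∷ c ∷ d ∷ t ∷ []) ⟩
  3 + x * 3 + t * (6 + n) + c * 2 + (a + 3 * b + (c + 3 * d)) ∎)
  where open ≡-Reasoning

normal-form-≢ : ∀ {n m a b} x c d → n ≡ suc (2 * m) → a ≤ 2 → a + 3 * b < n →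
                (a + b) * n + 2 * (a + 3 * b) ≢ suc (x + c + d) * n + 2 * (c + 3 * d)
normal-form-≢ {n} {m} {a} {b} x c d odd a≤2 a+3b<n eq
  with shift-odd-multiple {m = m} (a + b) (suc (x + c + d)) odd a+3b<n eq
... | t , h₁ , h₂ = defect-absurd {x = x} {t} {c} n a≤2 (defect n {a} {b} {x} {c} {d} {t} h₁ h₂)

gens : ℕ → List ℕ
gens k = 6 * k + 5 ∷ 6 * k + 7 ∷ 6 * k + 11 ∷ []

6k+5≡1+2[3k+2] : ∀ k → 6 * k + 5 ≡ suc (2 * (3 * k + 2))
6k+5≡1+2[3k+2] = solve-∀

combination-normal-form : ∀ k x c d →
  x * (6 * k + 5) + c * (6 * k + 7) + d * (6 * k + 11) ≡ (x + c + d) * (6 * k + 5) + 2 * (c + 3 * d)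
combination-normal-form = solve-∀

C⇒a+3b<6k+5 : ∀ k {a b} → C k a b → a + 3 * b < 6 * k + 5
C⇒a+3b<6k+5 k {a} {b} (a≤2 , b≤2k+1 , not-corner) =
  subst (a + 3 * b <_) 2+3[2k+1]≡6k+5 (bound a≤2)
  where
  2+3[2k+1]≡6k+5 : 2 + 3 * (2 * k + 1) ≡ 6 * k + 5
  2+3[2k+1]≡6k+5 = solve (k ∷ [])
  3b≤ : 3 * b ≤ 3 * (2 * k + 1)
  3b≤ = *-monoʳ-≤ 3 b≤2k+1
  bound : a ≤ 2 → a + 3 * b < 2 + 3 * (2 * k + 1)
  bound z≤n             = s≤s (m≤n⇒m≤1+n 3b≤)
  bound (s≤s z≤n)       = s≤s (s≤s 3b≤)
  bound (s≤s (s≤s z≤n)) = +-monoʳ-< 2 (*-monoʳ-< 3 (≤∧≢⇒< b≤2k+1 λ b≡ → not-corner (refl , b≡)))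

C⇒Apéry : ∀ k {a b} → C k a b → Apéry (gens k) (6 * k + 5) (a * (6 * k + 7) + b * (6 * k + 11))
C⇒Apéry k {a} {b} cab@(a≤2 , _) = Apéry-intro (combination∈⟨⟩ 0 a b) irreducible
  where
  irreducible : ∀ {t} → ⟨ gens k ⟩ t → a * (6 * k + 7) + b * (6 * k + 11) ≢ 6 * k + 5 + t
  irreducible t∈ eq with ∈⟨⟩⇒combination t∈
  ... | x , c , d , refl =
    normal-form-≢ {m = 3 * k + 2} x c d (6k+5≡1+2[3k+2] k) a≤2 (C⇒a+3b<6k+5 k cab) (begin
      (a + b) * (6 * k + 5) + 2 * (a + 3 * b)
        ≡⟨ combination-normal-form k 0 a b ⟨
      a * (6 * k + 7) + b * (6 * k + 11)
        ≡⟨ eq ⟩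
      6 * k + 5 + (x * (6 * k + 5) + c * (6 * k + 7) + d * (6 * k + 11))
        ≡⟨ cong (6 * k + 5 +_) (combination-normal-form k x c d) ⟩
      6 * k + 5 + ((x + c + d) * (6 * k + 5) + 2 * (c + 3 * d))
        ≡⟨ +-assoc (6 * k + 5) _ _ ⟨
      suc (x + c + d) * (6 * k + 5) + 2 * (c + 3 * d) ∎)
    where open ≡-Reasoning

Apéry⇒C : ∀ k {s} → Apéry (gens k) (6 * k + 5) s →
          ∃[ a ] ∃[ b ] (C k a b × s ≡ a * (6 * k + 7) + b * (6 * k + 11))
Apéry⇒C k ap with ∈⟨⟩⇒combination (proj₁ ap)
... | suc x , c , d , refl =
  ⊥-elim (Apéry⇒≢n+ ap (combination∈⟨⟩ x c d) (solve (k ∷ x ∷ c ∷ d ∷ [])))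
... | zero , c , d , refl with m≤n⊎m≡1+n+o c 2 | m≤n⊎m≡1+n+o d (2 * k + 1)
...   | inj₂ (e , refl) | _ =
  ⊥-elim (Apéry⇒≢n+ ap (combination∈⟨⟩ 1 e (suc d)) (solve (k ∷ e ∷ d ∷ [])))
...   | inj₁ _ | inj₂ (e , refl) =
  ⊥-elim (Apéry⇒≢n+ ap (combination∈⟨⟩ (2 * k + 2) (suc c) e) (solve (k ∷ c ∷ e ∷ [])))
...   | inj₁ c≤2 | inj₁ d≤2k+1 = c , d , (c≤2 , d≤2k+1 , corner-reducible) , refl
  where
  corner-reducible : ¬ (c ≡ 2 × d ≡ 2 * k + 1)
  corner-reducible (refl , refl) = Apéry⇒≢n+ ap (combination∈⟨⟩ (2 * k + 4) 0 0) (solve (k ∷ []))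

theorem8 : (k s : ℕ) →
    Apéry (6 * k + 5 ∷ 6 * k + 7 ∷ 6 * k + 11 ∷ []) (6 * k + 5) s
      ⇔ (∃[ a ] ∃[ b ] (C k a b × s ≡ a * (6 * k + 7) + b * (6 * k + 11)))
theorem8 k s = mk⇔ (Apéry⇒C k) λ { (a , b , cab , refl) → C⇒Apéry k cab }
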